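{- Let $G$ be a finite simple graph with no isolated vertices and let $G'$ be a spanning subgraph of $G$ with no isolated vertices. Then $h(G)\le h(G')+|E(G)|-|E(G')|$. In particular, if $G'$ is single-headed then $G$ is single-headed.
   Context: A directed 3-hypergraph $H=(V,F)$ consists of hyperarcs $u,v\to w$ (body $\{u,v\}$ of two distinct vertices, head $w$). The closure $cl_H(S)$ of $S\subseteq V$ is obtained by forward chaining: mark $S$; while some hyperarc $a,b\to c$ has $a,b$ marked and $c$ unmarked, mark $c$. $H$ represents $G=(V,E)$ if for all distinct $u,v$: $(u,v)\in E\Rightarrow cl_H(\{u,v\})=V$ and $(u,v)\notin E\Rightarrow cl_H(\{u,v\})=\{u,v\}$. The hydra number $h(G)$ is the minimum number of hyperarcs of a directed 3-hypergraph on $V$ representing $G$; $G$ is single-headed if $h(G)=|E(G)|$. A spanning subgraph has the same vertex set and a subset of the edges. -}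

module Defs where

open import Data.Nat using (ℕ; _<_; _≤_; _+_; _∸_)
open import Data.Nat.Properties using (_<?_)
open import Data.Fin using (Fin; toℕ)
open import Data.Bool using (Bool; true; false; T)
open import Data.Bool.Properties using (T?)
open import Data.List using (List; length; filter; cartesianProduct; allFin)
open import Data.List.Membership.Propositional using (_∈_)
open import Data.List.Relation.Unary.Unique.Propositional using (Unique)
open import Data.Product using (_×_; _,_; ∃; Σ)
open import Data.Sum using (_⊎_)
open import Relation.Nullary using (¬_)
open import Relation.Nullary.Decidable using (_×-dec_)
open import Relation.Binary.PropositionalEquality using (_≡_; _≢_)

record Graph (n : ℕ) : Set where
  field
    adj    : Fin n → Fin n → Bool
    sym    : ∀ u v → adj u v ≡ adj v u
    irrefl : ∀ v → adj v v ≡ false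
open Graph public

Edge : ∀ {n} → Graph n → Fin n → Fin n → Set
Edge G u v = T (adj G u v)

numEdges : ∀ {n} → Graph n → ℕ
numEdges {n} G =
  length (filter (λ p → (toℕ (Data.Product.proj₁ p) <? toℕ (Data.Product.proj₂ p))
                        ×-dec T? (adj G (Data.Product.proj₁ p) (Data.Product.proj₂ p)))
                 (cartesianProduct (allFin n) (allFin n)))

NoIsolated : ∀ {n} → Graph n → Set
NoIsolated {n} G = ∀ v → ∃ λ (u : Fin n) → Edge G v u

SpanningSubgraph : ∀ {n} → Graph n → Graph n → Set
SpanningSubgraph G' G = ∀ u v → Edge G' u v → Edge G u v

-- A hyperarc u,v → w with body {u,v} of two distinct vertices.
-- The unordered body is stored canonically with toℕ u < toℕ v.
record Hyperarc (n : ℕ) : Set where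
  constructor arc
  field
    tail₁ : Fin n
    tail₂ : Fin n
    ordered : toℕ tail₁ < toℕ tail₂
    head  : Fin n
open Hyperarc public

record Hypergraph (n : ℕ) : Set where
  field
    arcs   : List (Hyperarc n)
    unique : Unique arcs
open Hypergraph public

size : ∀ {n} → Hypergraph n → ℕ
size H = length (arcs H)

-- x ∈ cl_H({u,v}): least set containing u,v and closed under the hyperarcs
-- (exactly what forward chaining computes).
data InClosure {n} (H : Hypergraph n) (u v : Fin n) : Fin n → Set where
  base₁ : InClosure H u v u
  base₂ : InClosure H u v v
  step  : ∀ {a b c} (a<b : toℕ a < toℕ b) → arc a b a<b c ∈ arcs H →
          InClosure H u v a → InClosure H u v b → InClosure H u v c

Represents : ∀ {n} → Hypergraph n → Graph n → Set
Represents {n} H G = ∀ (u v : Fin n) → u ≢ v →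
    (Edge G u v → ∀ x → InClosure H u v x)
  × (¬ Edge G u v → ∀ x → InClosure H u v x → x ≡ u ⊎ x ≡ v)

IsHydraNumber : ∀ {n} → Graph n → ℕ → Set
IsHydraNumber {n} G k =
    (Σ (Hypergraph n) λ H → Represents H G × size H ≡ k)
  × (∀ (H : Hypergraph n) → Represents H G → k ≤ size H)

SingleHeaded : ∀ {n} → Graph n → Set
SingleHeaded G = IsHydraNumber G (numEdges G)

-- Given a representation H' of G', every edge uv of G outside G' is made to
-- span by one new hyperarc u,v → w, where w is a G'-neighbour of u: then w
-- lies in cl({u,v}), and cl({u,w}) is everything already in H'. Non-edges of
-- G stay closed because the new bodies are edges of G. For the second claim: with at least three
-- vertices, every edge uv of G must be the body of some hyperarc (its closure
-- escapes {u,v}), so h(G) ≥ |E(G)|; a single-headed G' without isolated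
-- vertices forces at least three vertices, because on two vertices the empty
-- hypergraph already represents every graph.
module Submission where

open import Defs
open import Data.Nat using (ℕ; _≤_; _+_; _∸_)
open import Data.Product using (_×_)

open import Data.Nat using (_<_; z≤n; s≤s)
open import Data.Nat.Properties
  using (_<?_; <-irrelevant; <-irrefl; <-asym; <-cmp; ≤-reflexive; ≤-trans; ≤-antisym;
         m≤n⇒m≤1+n; +-suc; +-assoc; +-monoʳ-≤; m+n≤o⇒m≤o∸n; m+n∸m≡n)
open import Data.Fin using (Fin; toℕ; zero; suc)
open import Data.Fin.Properties using (_≟_; toℕ-injective)
open import Data.Bool using (T)
open import Data.Bool.Properties using (T?)
open import Data.List using (List; []; _∷_; _++_; [_]; length; map; filter; cartesianProduct; allFin; deduplicate)
open import Data.List.Properties using (length-++; length-map; length-deduplicate)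
open import Data.List.Membership.Propositional using (_∈_; mapWith∈)
open import Data.List.Membership.Propositional.Properties
  using (∈-∃++; ∈-++⁺ˡ; ∈-++⁺ʳ; ∈-++⁻; ∈-map⁺; ∈-filter⁺; ∈-filter⁻; ∈-cartesianProduct⁺; ∈-allFin;
         ∈-deduplicate⁺; ∈-deduplicate⁻)
open import Data.List.Membership.Setoid.Properties using (length-mapWith∈)
open import Data.List.Relation.Binary.Subset.Propositional using (_⊆_)
open import Data.List.Relation.Unary.Any using (here; there)
open import Data.List.Relation.Unary.Any.Properties using (mapWith∈⁺; mapWith∈⁻)
open import Data.List.Relation.Unary.All as All using ()
open import Data.List.Relation.Unary.AllPairs using ([]; _∷_)
open import Data.List.Relation.Unary.Unique.Propositional using (Unique)
import Data.List.Relation.Unary.Unique.Propositional.Properties as Unique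
import Data.List.Relation.Unary.Unique.DecPropositional.Properties as DecUnique
open import Data.Product using (Σ; ∃; _,_; proj₁; proj₂)
open import Data.Sum using (_⊎_; inj₁; inj₂)
open import Data.Empty using (⊥-elim)
open import Function using (_∘_)
open import Relation.Nullary using (¬_; Dec; yes; no; ¬?)
open import Relation.Nullary.Decidable using (_×-dec_)
open import Relation.Unary using (Pred; Decidable)
open import Relation.Binary using (tri<; tri≈; tri>)
open import Relation.Binary.PropositionalEquality as ≡ using (_≡_; _≢_; refl; cong; subst; setoid; module ≡-Reasoning)

module _ {a} {A : Set a} where

  Unique⇒length-≤ : ∀ {xs ys : List A} → Unique xs → xs ⊆ ys → length xs ≤ length ys
  Unique⇒length-≤ {[]}     _            _     = z≤n
  Unique⇒length-≤ {x ∷ xs} (x∉xs ∷ !xs) xs⊆ys with ∈-∃++ (xs⊆ys (here refl))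
  ... | ys₁ , ys₂ , refl =
    ≤-trans (s≤s (Unique⇒length-≤ !xs xs⊆ys₁ys₂)) (≤-reflexive (≡.sym length-split))
    where
    open ≡-Reasoning
    length-split : length (ys₁ ++ x ∷ ys₂) ≡ 1 + length (ys₁ ++ ys₂)
    length-split = begin
      length (ys₁ ++ x ∷ ys₂)          ≡⟨ length-++ ys₁ ⟩
      length ys₁ + (1 + length ys₂)    ≡⟨ +-suc (length ys₁) (length ys₂) ⟩
      1 + (length ys₁ + length ys₂)    ≡⟨ cong (1 +_) (≡.sym (length-++ ys₁)) ⟩
      1 + length (ys₁ ++ ys₂)          ∎
    xs⊆ys₁ys₂ : xs ⊆ ys₁ ++ ys₂
    xs⊆ys₁ys₂ y∈xs with ∈-++⁻ ys₁ (xs⊆ys (there y∈xs))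
    ... | inj₁ y∈ys₁        = ∈-++⁺ˡ y∈ys₁
    ... | inj₂ (here refl)  = ⊥-elim (All.lookup x∉xs y∈xs refl)
    ... | inj₂ (there y∈ys₂) = ∈-++⁺ʳ ys₁ y∈ys₂

module _ {a p q r} {A : Set a} {P : Pred A p} {Q : Pred A q} {R : Pred A r}
         (P? : Decidable P) (Q? : Decidable Q) (R? : Decidable R)
         (P⇒R : ∀ {x} → P x → R x) (Q⇒R : ∀ {x} → Q x → R x) (P⇒¬Q : ∀ {x} → P x → ¬ Q x) where

  length-filter-disjoint-≤ : ∀ xs → length (filter P? xs) + length (filter Q? xs) ≤ length (filter R? xs)
  length-filter-disjoint-≤ []       = z≤n
  length-filter-disjoint-≤ (x ∷ xs) with P? x | Q? x | R? x | length-filter-disjoint-≤ xs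
  ... | yes px | yes qx | _      | _  = ⊥-elim (P⇒¬Q px qx)
  ... | yes px | no _   | no ¬rx | _  = ⊥-elim (¬rx (P⇒R px))
  ... | no _   | yes qx | no ¬rx | _  = ⊥-elim (¬rx (Q⇒R qx))
  ... | yes _  | no _   | yes _  | ih = s≤s ih
  ... | no _   | yes _  | yes _  | ih = ≤-trans (≤-reflexive (+-suc _ _)) (s≤s ih)
  ... | no _   | no _   | yes _  | ih = m≤n⇒m≤1+n ih
  ... | no _   | no _   | no _   | ih = ih

module _ {n : ℕ} where

  Edge⇒≢ : ∀ {G : Graph n} {u v} → Edge G u v → u ≢ v
  Edge⇒≢ {G} {u} e refl = subst T (irrefl G u) e

  Edge-sym : ∀ {G : Graph n} {u v} → Edge G u v → Edge G v u
  Edge-sym {G} {u} {v} = subst T (Graph.sym G u v)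

  <⇒≢ : {u v : Fin n} → toℕ u < toℕ v → u ≢ v
  <⇒≢ u<v refl = <-irrefl refl u<v

  pairs : List (Fin n × Fin n)
  pairs = cartesianProduct (allFin n) (allFin n)

  OrientedEdge : Graph n → Fin n × Fin n → Set
  OrientedEdge G (u , v) = toℕ u < toℕ v × Edge G u v

  orientedEdge? : (G : Graph n) → Decidable (OrientedEdge G)
  orientedEdge? G (u , v) = (toℕ u <? toℕ v) ×-dec T? (adj G u v)

  -- numEdges G is, by definition, the length of this list.
  orientedEdges : Graph n → List (Fin n × Fin n)
  orientedEdges G = filter (orientedEdge? G) pairs

  orientedEdges-unique : (G : Graph n) → Unique (orientedEdges G)
  orientedEdges-unique G =
    Unique.filter⁺ (orientedEdge? G) (Unique.cartesianProduct⁺ (Unique.allFin⁺ n) (Unique.allFin⁺ n))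

  ∈-orientedEdges⁺ : ∀ {G : Graph n} {p} → OrientedEdge G p → p ∈ orientedEdges G
  ∈-orientedEdges⁺ {G} {u , v} =
    ∈-filter⁺ (orientedEdge? G) (∈-cartesianProduct⁺ (∈-allFin u) (∈-allFin v))

  OrientedEdge⇒1≤numEdges : ∀ {G : Graph n} {p} → OrientedEdge G p → 1 ≤ numEdges G
  OrientedEdge⇒1≤numEdges {G} {p} e =
    Unique⇒length-≤ {xs = [ p ]} {orientedEdges G} (All.[] ∷ []) λ { (here refl) → ∈-orientedEdges⁺ {G = G} {p} e }

module _ {n : ℕ} {H : Hypergraph n} where

  InClosure-swap : ∀ {u v x} → InClosure H u v x → InClosure H v u x
  InClosure-swap base₁              = base₂
  InClosure-swap base₂              = base₁
  InClosure-swap (step a<b e∈H a b) = step a<b e∈H (InClosure-swap a) (InClosure-swap b)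

  InClosure-compose : ∀ {H' : Hypergraph n} → arcs H' ⊆ arcs H →
                      ∀ {u v a b} → InClosure H u v a → InClosure H u v b →
                      ∀ {x} → InClosure H' a b x → InClosure H u v x
  InClosure-compose H'⊆H a b base₁ = a
  InClosure-compose H'⊆H a b base₂ = b
  InClosure-compose H'⊆H a b (step c<d e∈H' c d) =
    step c<d (H'⊆H e∈H') (InClosure-compose H'⊆H a b c) (InClosure-compose H'⊆H a b d)

  BodyOn : Hyperarc n → Fin n → Fin n → Set
  BodyOn e u v = (tail₁ e ≡ u × tail₂ e ≡ v) ⊎ (tail₁ e ≡ v × tail₂ e ≡ u)

  head∈closure : ∀ {e u v} → e ∈ arcs H → BodyOn e u v → InClosure H u v (head e)
  head∈closure {e} e∈H (inj₁ (refl , refl)) = step (ordered e) e∈H base₁ base₂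
  head∈closure {e} e∈H (inj₂ (refl , refl)) = step (ordered e) e∈H base₂ base₁

  EscapingArc : Fin n → Fin n → Set
  EscapingArc u v = Σ (Hyperarc n) λ e → e ∈ arcs H × BodyOn e u v × head e ≢ u × head e ≢ v

  stay⊎escape : ∀ {e u v} → e ∈ arcs H → BodyOn e u v → head e ≡ u ⊎ head e ≡ v ⊎ EscapingArc u v
  stay⊎escape {e} {u} {v} e∈H body with head e ≟ u | head e ≟ v
  ... | yes c≡u | _       = inj₁ c≡u
  ... | no _    | yes c≡v = inj₂ (inj₁ c≡v)
  ... | no c≢u  | no c≢v  = inj₂ (inj₂ (e , e∈H , body , c≢u , c≢v))

  InClosure⇒pair⊎escape : ∀ {u v x} → InClosure H u v x → x ≡ u ⊎ x ≡ v ⊎ EscapingArc u v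
  InClosure⇒pair⊎escape base₁ = inj₁ refl
  InClosure⇒pair⊎escape base₂ = inj₂ (inj₁ refl)
  InClosure⇒pair⊎escape (step a<b e∈H a b)
    with InClosure⇒pair⊎escape a | InClosure⇒pair⊎escape b
  ... | inj₂ (inj₂ escape) | _                  = inj₂ (inj₂ escape)
  ... | _                  | inj₂ (inj₂ escape) = inj₂ (inj₂ escape)
  ... | inj₁ refl          | inj₁ refl          = ⊥-elim (<⇒≢ a<b refl)
  ... | inj₂ (inj₁ refl)   | inj₂ (inj₁ refl)   = ⊥-elim (<⇒≢ a<b refl)
  ... | inj₁ refl          | inj₂ (inj₁ refl)   = stay⊎escape e∈H (inj₁ (refl , refl))
  ... | inj₂ (inj₁ refl)   | inj₁ refl          = stay⊎escape e∈H (inj₂ (refl , refl))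

ThirdVertex : ℕ → Set
ThirdVertex n = ∀ (u v : Fin n) → u ≢ v → ∃ λ x → x ≢ u × x ≢ v

thirdVertex : ∀ m → ThirdVertex (3 + m)
thirdVertex m u v _ with zero ≟ u | zero ≟ v
... | no 0≢u   | no 0≢v = zero , 0≢u , 0≢v
... | yes refl | _      with suc zero ≟ v
...   | no 1≢v   = suc zero , (λ ()) , 1≢v
...   | yes refl = suc (suc zero) , (λ ()) , (λ ())
thirdVertex m u v _ | no _ | yes refl with suc zero ≟ u
...   | no 1≢u   = suc zero , 1≢u , (λ ())
...   | yes refl = suc (suc zero) , (λ ()) , (λ ())

numEdges≤size : ∀ {n} {G : Graph n} {H : Hypergraph n} →
                ThirdVertex n → Represents H G → numEdges G ≤ size H
numEdges≤size {n} {G} {H} third H-represents =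
  ≤-trans (Unique⇒length-≤ (orientedEdges-unique G) orientedEdges⊆bodies)
          (≤-reflexive (length-map body (arcs H)))
  where
  body : Hyperarc n → Fin n × Fin n
  body e = tail₁ e , tail₂ e
  orientedEdges⊆bodies : orientedEdges G ⊆ map body (arcs H)
  orientedEdges⊆bodies {u , v} uv∈oriented with proj₂ (∈-filter⁻ (orientedEdge? G) {xs = pairs} uv∈oriented)
  ... | u<v , uv∈E with third u v (<⇒≢ u<v)
  ... | x , x≢u , x≢v with InClosure⇒pair⊎escape (proj₁ (H-represents u v (<⇒≢ u<v)) uv∈E x)
  ... | inj₁ x≡u                                       = ⊥-elim (x≢u x≡u)
  ... | inj₂ (inj₁ x≡v)                                = ⊥-elim (x≢v x≡v)
  ... | inj₂ (inj₂ (e , e∈H , inj₁ (refl , refl) , _)) = ∈-map⁺ body e∈H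
  ... | inj₂ (inj₂ (e , e∈H , inj₂ (refl , refl) , _)) = ⊥-elim (<-asym u<v (ordered e))

∅ : ∀ {n} → Hypergraph n
∅ = record { arcs = [] ; unique = [] }

∅-represents : (G : Graph 2) → Represents ∅ G
∅-represents G u v u≢v = (λ _ x → spans u v x u≢v) , (λ _ _ → stays)
  where
  stays : ∀ {u v x} → InClosure ∅ u v x → x ≡ u ⊎ x ≡ v
  stays base₁          = inj₁ refl
  stays base₂          = inj₂ refl
  stays (step _ () _ _)
  spans : ∀ u v x → u ≢ v → InClosure ∅ u v x
  spans zero       zero       _          u≢v = ⊥-elim (u≢v refl)
  spans (suc zero) (suc zero) _          u≢v = ⊥-elim (u≢v refl)
  spans zero       (suc zero) zero       _   = base₁
  spans zero       (suc zero) (suc zero) _   = base₂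
  spans (suc zero) zero       zero       _   = base₂
  spans (suc zero) zero       (suc zero) _   = base₁

SingleHeaded⇒ThirdVertex : ∀ {n} (G : Graph n) → NoIsolated G → SingleHeaded G → ThirdVertex n
SingleHeaded⇒ThirdVertex {0}           G _ _ ()
SingleHeaded⇒ThirdVertex {1}           G _ _ zero zero u≢v = ⊥-elim (u≢v refl)
SingleHeaded⇒ThirdVertex {2}           G noIsolated (_ , minimal) with noIsolated zero
... | zero     , 00∈E = ⊥-elim (Edge⇒≢ {G = G} 00∈E refl)
... | suc zero , 01∈E
  with ≤-trans (OrientedEdge⇒1≤numEdges {G = G} (s≤s z≤n , 01∈E)) (minimal ∅ (∅-represents G))
...   | ()
SingleHeaded⇒ThirdVertex {ℕ.suc (ℕ.suc (ℕ.suc m))} G _ _ = thirdVertex m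

_≟ₐ_ : ∀ {n} (e e' : Hyperarc n) → Dec (e ≡ e')
arc a b a<b c ≟ₐ arc a' b' a'<b' c' with a ≟ a' | b ≟ b' | c ≟ c'
... | yes refl | yes refl | yes refl = yes (cong (λ a<b → arc a b a<b c) (<-irrelevant a<b a'<b'))
... | no a≢a'  | _        | _        = no λ { refl → a≢a' refl }
... | yes _    | no b≢b'  | _        = no λ { refl → b≢b' refl }
... | yes _    | yes _    | no c≢c'  = no λ { refl → c≢c' refl }

module Extension {n} (G G' : Graph n) (G'⊆G : SpanningSubgraph G' G) (noIsolated' : NoIsolated G')
                 (H' : Hypergraph n) (H'-represents : Represents H' G') where

  neighbour : Fin n → Fin n
  neighbour u = proj₁ (noIsolated' u)

  NewEdge : Fin n × Fin n → Set
  NewEdge (u , v) = OrientedEdge G (u , v) × ¬ Edge G' u v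

  newEdge? : Decidable NewEdge
  newEdge? (u , v) = orientedEdge? G (u , v) ×-dec ¬? (T? (adj G' u v))

  newEdges : List (Fin n × Fin n)
  newEdges = filter newEdge? pairs

  ∈newEdges⇒NewEdge : ∀ {p} → p ∈ newEdges → NewEdge p
  ∈newEdges⇒NewEdge = proj₂ ∘ ∈-filter⁻ newEdge? {xs = pairs}

  newArc : ∀ {p} → p ∈ newEdges → Hyperarc n
  newArc {u , v} uv∈new = arc u v (proj₁ (proj₁ (∈newEdges⇒NewEdge uv∈new))) (neighbour u)

  newArcs : List (Hyperarc n)
  newArcs = mapWith∈ newEdges newArc

  H : Hypergraph n
  H = record { arcs   = deduplicate _≟ₐ_ (arcs H' ++ newArcs)
             ; unique = DecUnique.deduplicate-! _≟ₐ_ (arcs H' ++ newArcs) }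

  H'⊆H : arcs H' ⊆ arcs H
  H'⊆H = ∈-deduplicate⁺ _≟ₐ_ ∘ ∈-++⁺ˡ

  newArcs⊆H : newArcs ⊆ arcs H
  newArcs⊆H = ∈-deduplicate⁺ _≟ₐ_ ∘ ∈-++⁺ʳ (arcs H')

  size-H≤ : size H ≤ size H' + numEdges G ∸ numEdges G'
  size-H≤ = ≤-trans (length-deduplicate _≟ₐ_ (arcs H' ++ newArcs))
                    (≤-trans (≤-reflexive length-H'++new) (m+n≤o⇒m≤o∸n _ counting))
    where
    length-H'++new : length (arcs H' ++ newArcs) ≡ size H' + length newEdges
    length-H'++new rewrite length-++ (arcs H') {newArcs} =
      cong (size H' +_) (length-mapWith∈ (setoid _) newEdges)
    counting : size H' + length newEdges + numEdges G' ≤ size H' + numEdges G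
    counting rewrite +-assoc (size H') (length newEdges) (numEdges G') =
      +-monoʳ-≤ (size H') (length-filter-disjoint-≤ newEdge? (orientedEdge? G') (orientedEdge? G)
                             proj₁ (λ { (u<v , uv∈E') → u<v , G'⊆G _ _ uv∈E' })
                             (λ new old → proj₂ new (proj₂ old)) pairs)

  newArc-on-edge : ∀ {e} → e ∈ newArcs → Edge G (tail₁ e) (tail₂ e)
  newArc-on-edge e∈new with mapWith∈⁻ newEdges newArc e∈new
  ... | p , p∈new , refl = proj₂ (proj₁ (∈newEdges⇒NewEdge p∈new))

  neighbour∈closure : ∀ {u v} → NewEdge (u , v) → InClosure H u v (neighbour u)
  neighbour∈closure {u} {v} new@((u<v , _) , _) =
    step u<v (newArcs⊆H (mapWith∈⁺ newArc ((u , v) , uv∈new , same-arc))) base₁ base₂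
    where
    uv∈new : (u , v) ∈ newEdges
    uv∈new = ∈-filter⁺ newEdge? (∈-cartesianProduct⁺ (∈-allFin u) (∈-allFin v)) new
    same-arc : arc u v u<v (neighbour u) ≡ newArc uv∈new
    same-arc = cong (λ u<v → arc u v u<v (neighbour u)) (<-irrelevant _ _)

  spans-oriented : ∀ {u v} → toℕ u < toℕ v → Edge G u v → ∀ x → InClosure H u v x
  spans-oriented {u} {v} u<v uv∈E x with T? (adj G' u v)
  ... | yes uv∈E' = InClosure-compose H'⊆H base₁ base₂ (proj₁ (H'-represents u v (<⇒≢ u<v)) uv∈E' x)
  ... | no uv∉E'  =
    InClosure-compose H'⊆H base₁ (neighbour∈closure ((u<v , uv∈E) , uv∉E'))
      (proj₁ (H'-represents u (neighbour u) (Edge⇒≢ {G = G'} uw∈E')) uw∈E' x)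
    where
    uw∈E' : Edge G' u (neighbour u)
    uw∈E' = proj₂ (noIsolated' u)

  spans : ∀ {u v} → u ≢ v → Edge G u v → ∀ x → InClosure H u v x
  spans {u} {v} u≢v uv∈E x with <-cmp (toℕ u) (toℕ v)
  ... | tri< u<v _ _  = spans-oriented u<v uv∈E x
  ... | tri≈ _ u≡v _  = ⊥-elim (u≢v (toℕ-injective u≡v))
  ... | tri> _ _ v<u  = InClosure-swap (spans-oriented v<u (Edge-sym {G = G} uv∈E) x)

  stays : ∀ {u v} → u ≢ v → ¬ Edge G u v → ∀ {x} → InClosure H u v x → x ≡ u ⊎ x ≡ v
  stays {u} {v} u≢v uv∉E x∈cl with InClosure⇒pair⊎escape x∈cl
  ... | inj₁ x≡u        = inj₁ x≡u
  ... | inj₂ (inj₁ x≡v) = inj₂ x≡v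
  ... | inj₂ (inj₂ (e , e∈H , body , c≢u , c≢v))
    with ∈-++⁻ (arcs H') (∈-deduplicate⁻ _≟ₐ_ (arcs H' ++ newArcs) e∈H)
  ...   | inj₁ e∈H' with proj₂ (H'-represents u v u≢v) (uv∉E ∘ G'⊆G u v) (head e) (head∈closure e∈H' body)
  ...     | inj₁ c≡u = ⊥-elim (c≢u c≡u)
  ...     | inj₂ c≡v = ⊥-elim (c≢v c≡v)
  stays {u} {v} u≢v uv∉E x∈cl | inj₂ (inj₂ (e , _ , body , _)) | inj₂ e∈new with body | newArc-on-edge e∈new
  ... | inj₁ (refl , refl) | uv∈E = ⊥-elim (uv∉E uv∈E)
  ... | inj₂ (refl , refl) | vu∈E = ⊥-elim (uv∉E (Edge-sym {G = G} vu∈E))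

  represents : Represents H G
  represents u v u≢v = spans u≢v , λ uv∉E _ → stays u≢v uv∉E

extend-representation : ∀ {n} (G G' : Graph n) {H' : Hypergraph n} →
  SpanningSubgraph G' G → NoIsolated G' → Represents H' G' →
  Σ (Hypergraph n) λ H → Represents H G × size H ≤ size H' + numEdges G ∸ numEdges G'
extend-representation G G' G'⊆G noIsolated' H'-represents = H , represents , size-H≤
  where open Extension G G' G'⊆G noIsolated' _ H'-represents

proposition3p5 : ∀ (n : ℕ) (G G' : Graph n) → NoIsolated G → NoIsolated G' → SpanningSubgraph G' G →
    (∀ (h h' : ℕ) → IsHydraNumber G h → IsHydraNumber G' h' → h ≤ h' + numEdges G ∸ numEdges G')
    × (SingleHeaded G' → SingleHeaded G)
proposition3p5 n G G' _ noIsolated' G'⊆G = hydra-bound , single-headed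
  where
  hydra-bound : ∀ (h h' : ℕ) → IsHydraNumber G h → IsHydraNumber G' h' → h ≤ h' + numEdges G ∸ numEdges G'
  hydra-bound h _ (_ , minimal) ((H' , H'-represents , refl) , _)
    with H , H-represents , size-H≤ ← extend-representation G G' G'⊆G noIsolated' H'-represents =
    ≤-trans (minimal H H-represents) size-H≤
  single-headed : SingleHeaded G' → SingleHeaded G
  single-headed G'-single@((H' , H'-represents , size-H'≡) , _)
    with H , H-represents , size-H≤ ← extend-representation G G' G'⊆G noIsolated' H'-represents =
    (H , H-represents , ≤-antisym upper (numEdges≤size {G = G} third H-represents)) ,
    λ K → numEdges≤size {G = G} {K} third
    where
    third : ThirdVertex n
    third = SingleHeaded⇒ThirdVertex G' noIsolated' G'-single
    upper : size H ≤ numEdges G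
    upper = subst (size H ≤_) (m+n∸m≡n (numEdges G') (numEdges G))
                  (subst (λ k → size H ≤ k + numEdges G ∸ numEdges G') size-H'≡ size-H≤)
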